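{- Let $n \ge 3$ and let $\mathcal A \in \mathcal S_n$ be an ordering (parenthesisation) of the matrix chain $M_1 M_2 \cdots M_n$. If there exists an instance $\boldsymbol k$ on which $\mathcal A$ is uniquely optimal, then there exist infinitely many instances on which $\mathcal A$ is uniquely optimal.
   Context: A matrix chain of length $n$ is a product $M_1 M_2 \cdots M_n$ where $M_i$ has size $k_{i-1}\times k_i$; an instance is a tuple $\boldsymbol k=(k_0,k_1,\ldots,k_n)$ of positive integers. $\mathcal S_n$ denotes the set of all (full) parenthesisations of $M_1\cdots M_n$ (there are $C_{n-1}$ of them, the $(n-1)$th Catalan number); each parenthesisation is called an ordering. Each of the $n-1$ multiplications in an ordering multiplies a subproduct $(M_{a+1}\cdots M_b)$ by $(M_{b+1}\cdots M_c)$ for some $0\le a<b<c\le n$ and has cost $k_a k_b k_c$. The cost $T(\mathcal A,\boldsymbol k)$ of ordering $\mathcal A$ on instance $\boldsymbol k$ is the sum of the costs of its $n-1$ multiplications. An ordering $\mathcal A$ is uniquely optimal on $\boldsymbol k$ if $T(\mathcal A,\boldsymbol k) < T(\mathcal B,\boldsymbol k)$ for every $\mathcal B\in\mathcal S_n\setminus\{\mathcal A\}$. -}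

module Defs where

open import Data.Nat using (ℕ; zero; suc; _+_; _*_; _<_)
open import Data.Vec using (Vec; []; _∷_)
open import Data.Vec.Relation.Unary.All using (All)
open import Relation.Binary.PropositionalEquality using (_≢_)

-- Full parenthesisations (orderings) of a chain of n matrices, as full
-- binary trees with n leaves.  Paren n is the set S_n.
data Paren : ℕ → Set where
  leaf : Paren 1
  node : ∀ {p q} → Paren p → Paren q → Paren (p + q)

-- k at index i (0-based), default 0 outside the range (never used).
at : ∀ {m} → Vec ℕ m → ℕ → ℕ
at []       _       = 0
at (x ∷ xs) zero    = x
at (x ∷ xs) (suc i) = at xs i

-- cost of computing the subproduct M_{a+1} ⋯ M_{a+m} with ordering t.
-- A node splitting (M_{a+1}⋯M_{a+p})(M_{a+p+1}⋯M_{a+p+q}) costs k_a k_{a+p} k_{a+p+q}.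
costFrom : ∀ {m} → Paren m → ℕ → (ℕ → ℕ) → ℕ
costFrom leaf a k = 0
costFrom (node {p} {q} l r) a k =
  costFrom l a k + costFrom r (a + p) k + k a * k (a + p) * k (a + p + q)

T : ∀ {n} → Paren n → Vec ℕ (suc n) → ℕ
T A k = costFrom A 0 (at k)

PositiveInstance : ∀ {n} → Vec ℕ (suc n) → Set
PositiveInstance k = All (0 <_) k

UniquelyOptimal : ∀ {n} → Paren n → Vec ℕ (suc n) → Set
UniquelyOptimal {n} A k = (B : Paren n) → B ≢ A → T A k < T B k

{-# OPTIONS --safe #-}
-- Every cost k_a k_b k_c is homogeneous of degree 3 in the instance, so scaling
-- an instance by c > 0 multiplies the cost of every ordering by c³ and keeps a
-- uniquely optimal ordering uniquely optimal.  Choosing c so large that c k₀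
-- exceeds the sum of the first entries of the finitely many given instances
-- yields an instance outside that list.
module Submission where

open import Defs
open import Data.Nat using (ℕ; suc; zero; _≤_; _<_; _+_; _*_; z<s; NonZero; >-nonZero)
open import Data.Nat.Properties
  using (*-zeroʳ; *-mono-<; *-monoʳ-<; m*n≢0; m≤m+n; m≤n⇒m≤o+n; ≤-trans; n<1+n; m≤m*n; <⇒≱)
open import Data.Nat.ListAction using (sum)
open import Data.Nat.Solver using (module +-*-Solver)
open import Data.Vec using (Vec; []; _∷_; map; head)
open import Data.Vec.Relation.Unary.All using (All; []; _∷_)
open import Data.List using (List) renaming (map to mapᴸ)
open import Data.List.Relation.Unary.Any using (here; there)
open import Data.List.Membership.Propositional using (_∈_; _∉_)
open import Data.List.Membership.Propositional.Properties using (∈-map⁺)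
open import Data.Product using (Σ; _×_; _,_)
open import Relation.Binary.PropositionalEquality
  using (_≡_; refl; sym; cong₂; subst₂; module ≡-Reasoning)

at-map-* : ∀ {m} c (k : Vec ℕ m) i → at (map (c *_) k) i ≡ c * at k i
at-map-* c []      i       = sym (*-zeroʳ c)
at-map-* c (x ∷ k) zero    = refl
at-map-* c (x ∷ k) (suc i) = at-map-* c k i

costFrom-homogeneous : ∀ {m} (A : Paren m) a c {k k′ : ℕ → ℕ} →
  (∀ i → k′ i ≡ c * k i) → costFrom A a k′ ≡ c * c * c * costFrom A a k
costFrom-homogeneous leaf               a c k′≡ck = sym (*-zeroʳ (c * c * c))
costFrom-homogeneous (node {p} {q} l r) a c {k} {k′} k′≡ck = begin
  costFrom l a k′ + costFrom r (a + p) k′ + k′ a * k′ (a + p) * k′ (a + p + q)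
    ≡⟨ cong₂ _+_ (cong₂ _+_ (costFrom-homogeneous l a c k′≡ck)
                            (costFrom-homogeneous r (a + p) c k′≡ck))
                 (cong₂ _*_ (cong₂ _*_ (k′≡ck a) (k′≡ck (a + p))) (k′≡ck (a + p + q))) ⟩
  c * c * c * x + c * c * c * y + c * u * (c * v) * (c * w)
    ≡⟨ cube-distrib c x y u v w ⟩
  c * c * c * (x + y + u * v * w) ∎
  where
  open ≡-Reasoning
  x y u v w : ℕ
  x = costFrom l a k
  y = costFrom r (a + p) k
  u = k a
  v = k (a + p)
  w = k (a + p + q)
  cube-distrib : ∀ c x y u v w →
    c * c * c * x + c * c * c * y + c * u * (c * v) * (c * w) ≡ c * c * c * (x + y + u * v * w)
  cube-distrib = solve 6 (λ c x y u v w →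
      c :* c :* c :* x :+ c :* c :* c :* y :+ c :* u :* (c :* v) :* (c :* w)
    := c :* c :* c :* (x :+ y :+ u :* v :* w)) refl
    where open +-*-Solver

T-scale : ∀ {n} (A : Paren n) c (k : Vec ℕ (suc n)) → T A (map (c *_) k) ≡ c * c * c * T A k
T-scale A c k = costFrom-homogeneous A 0 c (at-map-* c k)

UniquelyOptimal-scale : ∀ {n} {A : Paren n} {k : Vec ℕ (suc n)} c .{{_ : NonZero c}} →
  UniquelyOptimal A k → UniquelyOptimal A (map (c *_) k)
UniquelyOptimal-scale {A = A} {k} c optimal B B≢A =
  subst₂ _<_ (sym (T-scale A c k)) (sym (T-scale B c k))
    (*-monoʳ-< (c * c * c) {{m*n≢0 (c * c) c {{m*n≢0 c c}}}} (optimal B B≢A))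

map-*-positive : ∀ {m} {k : Vec ℕ m} c → All (0 <_) k → All (0 <_) (map (suc c *_) k)
map-*-positive c []          = []
map-*-positive c (x>0 ∷ k>0) = *-mono-< (z<s {n = c}) x>0 ∷ map-*-positive c k>0

∈⇒≤sum : ∀ {n ns} → n ∈ ns → n ≤ sum ns
∈⇒≤sum (here refl) = m≤m+n _ _
∈⇒≤sum (there n∈ns) = m≤n⇒m≤o+n _ (∈⇒≤sum n∈ns)

head>sum⇒∉ : ∀ {n} (v : Vec ℕ (suc n)) (L : List (Vec ℕ (suc n))) →
  sum (mapᴸ head L) < head v → v ∉ L
head>sum⇒∉ v L sum<head v∈L = <⇒≱ sum<head (∈⇒≤sum (∈-map⁺ head v∈L))

lemma4p1 : (n : ℕ) → 3 ≤ n → (A : Paren n)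
    → Σ (Vec ℕ (suc n)) (λ k → PositiveInstance k × UniquelyOptimal A k)
    → (L : List (Vec ℕ (suc n)))
    → Σ (Vec ℕ (suc n)) (λ k → PositiveInstance k × UniquelyOptimal A k × k ∉ L)
lemma4p1 n _ A (k@(k₀ ∷ _) , k>0@(k₀>0 ∷ _) , optimal) L =
  map (c *_) k , map-*-positive S k>0 , UniquelyOptimal-scale {k = k} c optimal ,
  head>sum⇒∉ (map (c *_) k) L S<ck₀
  where
  S = sum (mapᴸ head L)
  c = suc S
  S<ck₀ : S < c * k₀
  S<ck₀ = ≤-trans (n<1+n S) (m≤m*n c k₀ {{>-nonZero k₀>0}})
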